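{- Let $\{U_n\}_{n\ge0}$ be defined by $U_0=0$, $U_1=1$, $U_{n+2}=6U_{n+1}-U_n$, and for a positive integer $m$ let $z(m)$ be the smallest $n\ge1$ with $m\mid U_n$. Let $m=2^ap_1^{b_1}$ where $a\ge1$, $b_1\ge1$, $p_1$ is a prime with $p_1\equiv5\pmod 8$, and $z(p_1)=(p_1+1)/2$. Then for all integers $i,j\ge0$, $U_i\equiv U_j\pmod m$ holds if and only if $i\equiv j\pmod{z(m)}$. -}

module Defs where

open import Data.Nat as ℕ using (ℕ; zero; suc; _≤_; _<_)
open import Data.Integer as ℤ using (ℤ; +_; _-_; _*_)
open import Data.Integer.Divisibility as ℤD using ()
open import Data.Product using (_×_)
open import Relation.Nullary using (¬_)

U : ℕ → ℤ
U zero = + 0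
U (suc zero) = + 1
U (suc (suc n)) = + 6 * U (suc n) - U n

_≡_[mod_] : ℤ → ℤ → ℕ → Set
a ≡ b [mod m ] = (+ m) ℤD.∣ (a - b)

_∣U_ : ℕ → ℕ → Set
m ∣U n = (+ m) ℤD.∣ U n

IsRankOfApparition : ℕ → ℕ → Set
IsRankOfApparition m z =
  1 ≤ z × m ∣U z × (∀ n → 1 ≤ n → m ∣U n → z ≤ n)

-- Write W_n = U_{n+1} - 3 U_n (half of the companion Lucas sequence).
-- * Identities: the difference formula  U_{i+2v} - U_i = 2 U_v W_{i+v},  the
--   duplication formula U_{2v} = 2 U_v W_v, Cassini, and the Pell equation
--   W_n² - 8 U_n² = 1; all are proved by uniqueness of solutions of the recurrence.
-- * Divisibility: U_n ≡ n (mod 2), so W_n is odd and U_{i+d} ≡ U_i (mod 2) forces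
--   d even; the rank of apparition z(k) divides every n with k ∣ U_n as soon as
--   U_{z(k)+1} can be cancelled modulo k (true for primes k, and when U_{z(k)+1} ≡ 1).
-- * PrimePowers: cancelling 2^a p^b against factors prime to 2 and to p.
-- * Modulus: every W_x is prime to m (it is odd, and p ∣ W_x would give p ∣ U_{2x},
--   hence, z(p) being odd, p ∣ U_x, against the Pell equation).  So by the difference
--   formula m ∣ U_{i+2v} - U_i iff m ∣ U_{2v}; with parity this gives
--   m ∣ U_{i+d} - U_i iff z(m) ∣ d, which is the theorem for j = i + d.
module Submission where

open import Defs

module Identities where

  open import Data.Nat as ℕ using (ℕ; zero; suc)
  open import Data.Integer using (ℤ; +_; _+_; _-_; _*_)
  import Data.Integer.Properties as ℤP
  open import Data.Integer.Tactic.RingSolver using (solve-∀)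
  open import Data.Product using (_×_; _,_; proj₁)
  open import Relation.Binary.PropositionalEquality
  open ≡-Reasoning

  Recurrence : (ℕ → ℤ) → Set
  Recurrence f = ∀ n → f (suc (suc n)) ≡ + 6 * f (suc n) - f n

  U-recurrence : Recurrence U
  U-recurrence n = refl

  Recurrence-sub : ∀ {f g} → Recurrence f → Recurrence g → Recurrence (λ n → f n - g n)
  Recurrence-sub {f} {g} rf rg n = begin
    f (suc (suc n)) - g (suc (suc n))           ≡⟨ cong₂ _-_ (rf n) (rg n) ⟩
    (+ 6 * f (suc n) - f n) - (+ 6 * g (suc n) - g n)
      ≡⟨ regroup (f (suc n)) (f n) (g (suc n)) (g n) ⟩
    + 6 * (f (suc n) - g (suc n)) - (f n - g n)  ∎
    where
    regroup : ∀ a b c d → (+ 6 * a - b) - (+ 6 * c - d) ≡ + 6 * (a - c) - (b - d)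
    regroup = solve-∀

  Recurrence-scale : ∀ {f} c → Recurrence f → Recurrence (λ n → c * f n)
  Recurrence-scale {f} c rf n = begin
    c * f (suc (suc n))              ≡⟨ cong (c *_) (rf n) ⟩
    c * (+ 6 * f (suc n) - f n)      ≡⟨ regroup c (f (suc n)) (f n) ⟩
    + 6 * (c * f (suc n)) - c * f n  ∎
    where
    regroup : ∀ c a b → c * (+ 6 * a - b) ≡ + 6 * (c * a) - c * b
    regroup = solve-∀

  recurrence-unique : ∀ {f g} → Recurrence f → Recurrence g
                    → f 0 ≡ g 0 → f 1 ≡ g 1 → ∀ n → f n ≡ g n
  recurrence-unique {f} {g} rf rg f0≡g0 f1≡g1 n = proj₁ (consecutive n)
    where
    consecutive : ∀ n → f n ≡ g n × f (suc n) ≡ g (suc n)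
    consecutive zero = f0≡g0 , f1≡g1
    consecutive (suc n) with consecutive n
    ... | fn≡gn , fn+1≡gn+1 =
      fn+1≡gn+1 , trans (rf n) (trans (cong₂ (λ x y → + 6 * x - y) fn+1≡gn+1 fn≡gn) (sym (rg n)))

  W : ℕ → ℤ
  W n = U (suc n) - + 3 * U n

  W-recurrence : Recurrence W
  W-recurrence = Recurrence-sub {λ n → U (suc n)} {λ n → + 3 * U n} (λ n → refl)
                   (Recurrence-scale {U} (+ 3) U-recurrence)

  U-addition : ∀ s n → U (suc (n ℕ.+ s)) ≡ U (suc s) * U (suc n) - U s * U n
  U-addition s = recurrence-unique (λ n → refl)
    (Recurrence-sub {λ n → U (suc s) * U (suc n)} {λ n → U s * U n}
      (Recurrence-scale {λ n → U (suc n)} (U (suc s)) (λ n → refl))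
      (Recurrence-scale {U} (U s) U-recurrence))
    (initial₀ (U (suc s)) (U s)) (initial₁ (U (suc s)) (U s))
    where
    initial₀ : ∀ a b → a ≡ a * + 1 - b * + 0
    initial₀ = solve-∀
    initial₁ : ∀ a b → + 6 * a - b ≡ a * + 6 - b * + 1
    initial₁ = solve-∀

  cassini : ∀ n → U (suc n) * U (suc n) - U n * U (suc (suc n)) ≡ + 1
  cassini zero = refl
  cassini (suc n) = trans (shift (U (suc n)) (U n)) (cassini n)
    where
    shift : ∀ x w → (+ 6 * x - w) * (+ 6 * x - w) - x * (+ 6 * (+ 6 * x - w) - x)
                  ≡ x * x - w * (+ 6 * x - w)
    shift = solve-∀

  -- The Pell equation W² - 8 U² = 1 is Cassini's identity in disguise.
  pell : ∀ n → W n * W n - + 8 * (U n * U n) ≡ + 1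
  pell n = trans (rewrite-in-U (U n) (U (suc n))) (cassini n)
    where
    rewrite-in-U : ∀ u x → (x - + 3 * u) * (x - + 3 * u) - + 8 * (u * u) ≡ x * x - u * (+ 6 * x - u)
    rewrite-in-U = solve-∀

  -- Duplication formulas, the values at i = 0 and i = 1 of the difference formula.
  U-double : ∀ v → U (v ℕ.+ v) ≡ + 2 * U v * W v
  U-double zero = refl
  U-double (suc v) = trans (U-addition (suc v) v) (factor (U (suc v)) (U v))
    where
    factor : ∀ x u → (+ 6 * x - u) * x - x * u ≡ + 2 * x * ((+ 6 * x - u) - + 3 * x)
    factor = solve-∀

  U-double-succ : ∀ v → U (suc (v ℕ.+ v)) - + 1 ≡ + 2 * U v * W (suc v)
  U-double-succ v = begin
    U (suc (v ℕ.+ v)) - + 1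
      ≡⟨ cong₂ _-_ (U-addition v v) (sym (cassini v)) ⟩
    (U (suc v) * U (suc v) - U v * U v) - (U (suc v) * U (suc v) - U v * U (suc (suc v)))
      ≡⟨ factor (U v) (U (suc v)) ⟩
    + 2 * U v * W (suc v) ∎
    where
    factor : ∀ u x → (x * x - u * u) - (x * x - u * (+ 6 * x - u)) ≡ + 2 * u * ((+ 6 * x - u) - + 3 * x)
    factor = solve-∀

  -- Difference formula: both sides solve the recurrence in i.
  U-difference : ∀ v i → U (i ℕ.+ (v ℕ.+ v)) - U i ≡ + 2 * U v * W (i ℕ.+ v)
  U-difference v = recurrence-unique
    (Recurrence-sub {λ i → U (i ℕ.+ (v ℕ.+ v))} {U} (λ i → refl) U-recurrence)
    (Recurrence-scale {λ i → W (i ℕ.+ v)} (+ 2 * U v) (λ i → W-recurrence (i ℕ.+ v)))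
    (trans (ℤP.+-identityʳ (U (v ℕ.+ v))) (U-double v))
    (U-double-succ v)

module Divisibility where

  open Identities
  open import Data.Nat as ℕ using (ℕ; zero; suc; z≤n; s≤s)
  import Data.Nat.Properties as ℕP
  import Data.Nat.Divisibility as ℕD
  open import Data.Nat.DivMod using (_%_; _/_; m≡m%n+[m/n]*n; m%n<n)
  open import Data.Nat.Primality using (Prime; prime[2]; euclidsLemma; prime⇒nonTrivial)
  open import Data.Integer using (ℤ; +_; _+_; _-_; _*_; ∣_∣)
  import Data.Integer.Properties as ℤP
  open import Data.Integer.Divisibility.Signed
  open import Data.Integer.Tactic.RingSolver using (solve-∀)
  open import Data.Product using (_,_)
  open import Data.Sum using (inj₁; inj₂)
  open import Data.Empty using (⊥-elim)
  open import Relation.Nullary using (¬_)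
  open import Relation.Binary.PropositionalEquality
  open import Function.Bundles using (_⇔_; mk⇔)

  ∣m-n∣n⇒∣m : ∀ {k m n} → k ∣ m - n → k ∣ n → k ∣ m
  ∣m-n∣n⇒∣m k∣m-n k∣n = ∣m+n∣n⇒∣m k∣m-n (∣m⇒∣-m k∣n)

  ∣m∣m-n⇒∣n : ∀ {k m n} → k ∣ m → k ∣ m - n → k ∣ n
  ∣m∣m-n⇒∣n {n = n} k∣m k∣m-n = subst (_ ∣_) (ℤP.neg-involutive n) (∣m⇒∣-m (∣m+n∣m⇒∣n k∣m-n k∣m))

  prime∤1 : ∀ {p} → Prime p → ¬ (+ p ∣ + 1)
  prime∤1 p-prime p∣1 = ℕ.nonTrivial⇒≢1 {{prime⇒nonTrivial p-prime}} (ℕD.∣1⇒≡1 (∣⇒∣ᵤ p∣1))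

  -- U n ≡ n (mod 2), since U (n+2) - U n = 2 (3 U (n+1) - U n).
  U-parity : ∀ n → + 2 ∣ U n - + n
  U-parity zero = divides (+ 0) refl
  U-parity (suc zero) = divides (+ 0) refl
  U-parity (suc (suc n)) = subst (+ 2 ∣_) (sym (two-steps (U (suc n)) (U n) (+ n)))
    (∣m∣n⇒∣m+n (∣m⇒∣m*n (+ 3 * U (suc n) - U n - + 1) ∣-refl) (U-parity n))
    where
    two-steps : ∀ x u k → (+ 6 * x - u) - (+ 2 + k) ≡ + 2 * (+ 3 * x - u - + 1) + (u - k)
    two-steps = solve-∀

  -- Hence W n ≡ (n + 1) - 3 n (mod 2) is odd.
  W-odd : ∀ n → ¬ (+ 2 ∣ W n)
  W-odd n 2∣W = prime∤1 prime[2]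
    (subst (+ 2 ∣_) (sym (one (U (suc n)) (U n) (+ n)))
      (∣m∣n⇒∣m+n (∣m∣n⇒∣m+n (∣m∣n⇒∣m-n 2∣W (U-parity (suc n))) (∣n⇒∣m*n (+ 3) (U-parity n)))
                 (∣m⇒∣m*n (+ n) ∣-refl)))
    where
    one : ∀ x u k → + 1 ≡ (x - + 3 * u) - (x - (+ 1 + k)) + + 3 * (u - k) + + 2 * k
    one = solve-∀

  gap-even : ∀ i d → + 2 ∣ U (i ℕ.+ d) - U i → 2 ℕD.∣ d
  gap-even i d 2∣gap = ∣⇒∣ᵤ (subst (+ 2 ∣_) (isolate (U (i ℕ.+ d)) (U i) (+ i) (+ d))
    (∣m∣n⇒∣m+n (∣m∣n⇒∣m-n 2∣gap (U-parity (i ℕ.+ d))) (U-parity i)))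
    where
    isolate : ∀ a b x y → (a - b) - (a - (x + y)) + (b - x) ≡ y
    isolate = solve-∀

  recurrence-divisible : ∀ {k f} → Recurrence f → k ∣ f 0 → k ∣ f 1 → ∀ n → k ∣ f n
  recurrence-divisible _ k∣f0 _ zero = k∣f0
  recurrence-divisible {k} {f} rf k∣f0 k∣f1 (suc n) =
    recurrence-divisible {k} {λ n → f (suc n)} (λ n → rf (suc n)) k∣f1 k∣f2 n
    where
    k∣f2 : k ∣ f 2
    k∣f2 = subst (k ∣_) (sym (rf 0)) (∣m∣n⇒∣m-n (∣n⇒∣m*n (+ 6) k∣f1) k∣f0)

  k∣0 : ∀ {k} → k ∣ + 0
  k∣0 {k} = divides (+ 0) (sym (ℤP.*-zeroˡ k))

  U-shift : ∀ {k z} → k ∣ U z → ∀ n → k ∣ U (n ℕ.+ z) - U (suc z) * U n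
  U-shift {k} {z} k∣Uz = recurrence-divisible {k} {λ n → U (n ℕ.+ z) - U (suc z) * U n}
    (Recurrence-sub {λ n → U (n ℕ.+ z)} {λ n → U (suc z) * U n}
      (λ n → refl) (Recurrence-scale {U} (U (suc z)) U-recurrence))
    (subst (k ∣_) (sym (at-zero (U z) (U (suc z)))) k∣Uz)
    (subst (k ∣_) (sym (at-one (U (suc z)))) k∣0)
    where
    at-zero : ∀ a c → a - c * + 0 ≡ a
    at-zero = solve-∀
    at-one : ∀ c → c - c * + 1 ≡ + 0
    at-one = solve-∀

  U-multiples : ∀ {k z} → k ∣ U z → ∀ q → k ∣ U (q ℕ.* z)
  U-multiples k∣Uz zero = k∣0
  U-multiples {k} {z} k∣Uz (suc q) = subst (λ n → k ∣ U n) (ℕP.+-comm (q ℕ.* z) z)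
    (∣m-n∣n⇒∣m (U-shift k∣Uz (q ℕ.* z)) (∣n⇒∣m*n (U (suc z)) (U-multiples k∣Uz q)))

  Cancellable : ℤ → ℤ → Set
  Cancellable k κ = ∀ x → k ∣ κ * x → k ∣ x

  -- By Cassini's identity, consecutive terms of U are coprime.
  consecutive-coprime : ∀ {k} n → k ∣ U n → k ∣ U (suc n) → k ∣ + 1
  consecutive-coprime zero _ k∣U1 = k∣U1
  consecutive-coprime (suc n) k∣Un+1 k∣Un+2 = subst (_ ∣_) (cassini (suc n))
    (∣m∣n⇒∣m-n (∣m⇒∣m*n (U (suc (suc n))) k∣Un+2) (∣m⇒∣m*n (U (suc (suc (suc n)))) k∣Un+1))

  -- By the Pell equation, U x and W x are coprime.
  pell-coprime : ∀ {k} x → k ∣ U x → k ∣ W x → k ∣ + 1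
  pell-coprime x k∣Ux k∣Wx = subst (_ ∣_) (pell x)
    (∣m∣n⇒∣m-n (∣m⇒∣m*n (W x) k∣Wx) (∣n⇒∣m*n (+ 8) (∣m⇒∣m*n (U x) k∣Ux)))

  cancellable-prime : ∀ {p} z → Prime p → + p ∣ U z → Cancellable (+ p) (U (suc z))
  cancellable-prime {p} z p-prime p∣Uz x p∣κx
    with euclidsLemma ∣ U (suc z) ∣ ∣ x ∣ p-prime (subst (p ℕD.∣_) (ℤP.abs-* (U (suc z)) x) (∣⇒∣ᵤ p∣κx))
  ... | inj₁ p∣κ = ⊥-elim (prime∤1 p-prime (consecutive-coprime z p∣Uz (∣ᵤ⇒∣ p∣κ)))
  ... | inj₂ p∣x = ∣ᵤ⇒∣ p∣x

  cancellable-unit : ∀ {k κ} → k ∣ κ - + 1 → Cancellable k κ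
  cancellable-unit {k} {κ} k∣κ-1 x k∣κx =
    subst (k ∣_) (peel κ x) (∣m∣n⇒∣m-n k∣κx (∣m⇒∣m*n x k∣κ-1))
    where
    peel : ∀ c x → c * x - (c - + 1) * x ≡ x
    peel = solve-∀

  -- The rank of apparition z of k divides every n with k ∣ U n, provided U (z+1) is
  -- cancellable modulo k: strip multiples of z off n, and the remainder must vanish
  -- by minimality of z.
  rank-divides : ∀ {k z} → IsRankOfApparition k z → Cancellable (+ k) (U (suc z))
               → ∀ n → + k ∣ U n → z ℕD.∣ n
  rank-divides {k} {z} (z≥1 , k∣Uz , minimal) cancel n k∣Un =
    ℕD.m%n≡0⇒n∣m n z (remainder-zero (n % z) (m%n<n n z)
      (drop-multiples (n / z) (n % z) (subst (λ i → + k ∣ U i) (m≡m%n+[m/n]*n n z) k∣Un)))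
    where
    instance _ = ℕ.>-nonZero z≥1

    drop-period : ∀ i → + k ∣ U (i ℕ.+ z) → + k ∣ U i
    drop-period i k∣Ui+z = cancel (U i) (∣m∣m-n⇒∣n k∣Ui+z (U-shift (∣ᵤ⇒∣ k∣Uz) i))

    drop-multiples : ∀ q r → + k ∣ U (r ℕ.+ q ℕ.* z) → + k ∣ U r
    drop-multiples zero r h = subst (λ i → + k ∣ U i) (ℕP.+-identityʳ r) h
    drop-multiples (suc q) r h =
      drop-multiples q r (drop-period (r ℕ.+ q ℕ.* z) (subst (λ i → + k ∣ U i) reassoc h))
      where
      reassoc : r ℕ.+ (z ℕ.+ q ℕ.* z) ≡ r ℕ.+ q ℕ.* z ℕ.+ z
      reassoc = trans (cong (r ℕ.+_) (ℕP.+-comm z (q ℕ.* z))) (sym (ℕP.+-assoc r (q ℕ.* z) z))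

    remainder-zero : ∀ r → r ℕ.< z → + k ∣ U r → r ≡ 0
    remainder-zero zero _ _ = refl
    remainder-zero (suc r) r<z k∣Ur = ⊥-elim (ℕP.<⇒≱ r<z (minimal (suc r) (s≤s z≤n) (∣⇒∣ᵤ k∣Ur)))


  mod⇔∣ : ∀ {x y m} → (x ≡ y [mod m ]) ⇔ (+ m ∣ y - x)
  mod⇔∣ {x} {y} = mk⇔ (λ x≡y → ∣ᵤ⇒∣ (subst (_ ℕD.∣_) (ℤP.∣i-j∣≡∣j-i∣ x y) x≡y))
                      (λ m∣y-x → subst (_ ℕD.∣_) (ℤP.∣i-j∣≡∣j-i∣ y x) (∣⇒∣ᵤ m∣y-x))

  mod-sym : ∀ x y {m} → x ≡ y [mod m ] → y ≡ x [mod m ]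
  mod-sym x y = subst (_ ℕD.∣_) (ℤP.∣i-j∣≡∣j-i∣ x y)

  index-mod : ∀ {z} i d → ((+ i) ≡ (+ (i ℕ.+ d)) [mod z ]) ⇔ z ℕD.∣ d
  index-mod {z} i d = mk⇔ (subst (z ℕD.∣_) distance) (subst (z ℕD.∣_) (sym distance))
    where
    distance : ∣ + i - + (i ℕ.+ d) ∣ ≡ d
    distance = trans (ℤP.∣i-j∣≡∣j-i∣ (+ i) (+ (i ℕ.+ d))) (cong ∣_∣ (cancel (+ i) (+ d)))
      where
      cancel : ∀ x y → (x + y) - x ≡ y
      cancel = solve-∀

module PrimePowers where

  open import Data.Nat
  open import Data.Nat.Properties
  open import Data.Nat.Divisibility
  open import Data.Nat.DivMod using (m≡m%n+[m/n]*n; m*n/n≡m; [m+kn]%n≡m%n)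
  open import Data.Nat.Primality using (Prime; prime[2]; euclidsLemma; prime⇒nonTrivial; prime⇒nonZero; prime⇒irreducible)
  open import Data.Nat.Coprimality using (Coprime; coprime-divisor)
  open import Data.Nat.Tactic.RingSolver using (solve-∀)
  open import Data.Product using (∃-syntax; _,_)
  open import Data.Sum using (inj₁; inj₂)
  open import Data.Empty using (⊥-elim)
  open import Relation.Nullary using (¬_; contradiction)
  open import Relation.Binary.PropositionalEquality
  open ≡-Reasoning

  prime∤⇒coprime : ∀ {p n} → Prime p → ¬ p ∣ n → Coprime n p
  prime∤⇒coprime p-prime p∤n (d∣n , d∣p) with prime⇒irreducible p-prime d∣p
  ... | inj₁ d≡1 = d≡1
  ... | inj₂ refl = ⊥-elim (p∤n d∣n)

  odd-∣-double : ∀ {n x} → ¬ 2 ∣ n → n ∣ x + x → n ∣ x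
  odd-∣-double {n} {x} 2∤n n∣x+x =
    coprime-divisor (prime∤⇒coprime prime[2] 2∤n) (subst (n ∣_) (cong (x +_) (sym (+-identityʳ x))) n∣x+x)

  half : ∀ {d} → 2 ∣ d → ∃[ v ] d ≡ v + v
  half (divides v refl) = v , trans (*-comm v 2) (cong (v +_) (+-identityʳ v))

  n∣n^a : ∀ n {a} → 1 ≤ a → n ∣ n ^ a
  n∣n^a n (s≤s z≤n) = m∣m*n _

  prime∤power : ∀ {p q} a → Prime p → ¬ p ∣ q → ¬ p ∣ q ^ a
  prime∤power zero p-prime _ p∣1 = nonTrivial⇒≢1 {{prime⇒nonTrivial p-prime}} (∣1⇒≡1 p∣1)
  prime∤power {q = q} (suc a) p-prime p∤q p∣q^1+a with euclidsLemma q (q ^ a) p-prime p∣q^1+a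
  ... | inj₁ p∣q = p∤q p∣q
  ... | inj₂ p∣q^a = prime∤power a p-prime p∤q p∣q^a

  prime-power-cancel : ∀ {p w} b c → Prime p → ¬ p ∣ w → p ^ b ∣ w * c → p ^ b ∣ c
  prime-power-cancel zero c _ _ _ = 1∣ c
  prime-power-cancel {p} {w} (suc b) c p-prime p∤w p^1+b∣wc
    with euclidsLemma w c p-prime (m*n∣⇒m∣ p (p ^ b) p^1+b∣wc)
  ... | inj₁ p∣w = contradiction p∣w p∤w
  ... | inj₂ (divides c′ refl) = subst (p ^ suc b ∣_) (*-comm p c′) (*-monoʳ-∣ p p^b∣c′)
    where
    instance _ = prime⇒nonZero p-prime
    p^b∣c′ : p ^ b ∣ c′
    p^b∣c′ = prime-power-cancel b c′ p-prime p∤w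
      (*-cancelˡ-∣ p (subst (p ^ suc b ∣_) (trans (sym (*-assoc w c′ p)) (*-comm (w * c′) p)) p^1+b∣wc))

  prime-powers-product : ∀ {p q n} a b → Prime p → ¬ p ∣ q → q ^ a ∣ n → p ^ b ∣ n → q ^ a * p ^ b ∣ n
  prime-powers-product {p} {q} a b p-prime p∤q (divides t refl) p^b∣n =
    subst (q ^ a * p ^ b ∣_) (*-comm (q ^ a) t) (*-monoʳ-∣ (q ^ a)
      (prime-power-cancel b t p-prime (prime∤power a p-prime p∤q) (subst (p ^ b ∣_) (*-comm t (q ^ a)) p^b∣n)))

  prime-powers-cancel : ∀ {p q w} a b c → Prime q → Prime p → ¬ p ∣ q → ¬ q ∣ w → ¬ p ∣ w
                      → q ^ a * p ^ b ∣ w * c → q ^ a * p ^ b ∣ c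
  prime-powers-cancel {p} {q} a b c q-prime p-prime p∤q q∤w p∤w m∣wc = prime-powers-product a b p-prime p∤q
    (prime-power-cancel a c q-prime q∤w (m*n∣⇒m∣ (q ^ a) (p ^ b) m∣wc))
    (prime-power-cancel b c p-prime p∤w (m*n∣⇒n∣ (q ^ a) (p ^ b) m∣wc))

  ≡5-mod-8⇒∤2 : ∀ {p} → Prime p → p % 8 ≡ 5 → ¬ p ∣ 2
  ≡5-mod-8⇒∤2 p-prime p≡5 p∣2 with prime⇒irreducible prime[2] p∣2
  ... | inj₁ refl = nonTrivial⇒≢1 {{prime⇒nonTrivial p-prime}} refl
  ... | inj₂ refl = contradiction p≡5 λ ()

  ≡5-mod-8⇒half-odd : ∀ p → p % 8 ≡ 5 → ¬ 2 ∣ (p + 1) / 2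
  ≡5-mod-8⇒half-odd p p≡5 2∣half = 0≢1+n (begin
    0                                ≡⟨ n∣m⇒m%n≡0 _ 2 (subst (2 ∣_) half≡ 2∣half) ⟨
    (1 + (1 + q * 2) * 2) % 2        ≡⟨ [m+kn]%n≡m%n 1 (1 + q * 2) 2 ⟩
    1                                ∎)
    where
    q = p / 8
    regroup : ∀ q → 5 + q * 8 + 1 ≡ (1 + (1 + q * 2) * 2) * 2
    regroup = solve-∀
    p+1≡ : p + 1 ≡ (1 + (1 + q * 2) * 2) * 2
    p+1≡ = begin
      p + 1                      ≡⟨ cong (_+ 1) (m≡m%n+[m/n]*n p 8) ⟩
      p % 8 + q * 8 + 1          ≡⟨ cong (λ r → r + q * 8 + 1) p≡5 ⟩
      5 + q * 8 + 1              ≡⟨ regroup q ⟩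
      (1 + (1 + q * 2) * 2) * 2  ∎
    half≡ : (p + 1) / 2 ≡ 1 + (1 + q * 2) * 2
    half≡ = trans (cong (_/ 2) p+1≡) (m*n/n≡m (1 + (1 + q * 2) * 2) 2)

open import Data.Nat as ℕ using (ℕ; _^_)
open import Data.Nat.Primality using (Prime)
open import Data.Nat.DivMod using (_%_; _/_)
open import Relation.Binary.PropositionalEquality using (_≡_)

module Modulus (a b p : ℕ) (a≥1 : 1 ℕ.≤ a) (p-prime : Prime p) (p≡5 : p % 8 ≡ 5)
               (rank-p : IsRankOfApparition p ((p ℕ.+ 1) / 2))
               (z : ℕ) (rank-m : IsRankOfApparition (2 ^ a ℕ.* p ^ b) z) where

  open Identities
  open Divisibility
  open PrimePowers using (prime-powers-cancel; ≡5-mod-8⇒∤2; ≡5-mod-8⇒half-odd; odd-∣-double; half; n∣n^a)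
  import Data.Nat.Properties as ℕP
  import Data.Nat.Divisibility as ℕD
  open import Data.Nat.Primality using (prime[2])
  open import Data.Integer using (+_; _-_; _*_; ∣_∣)
  import Data.Integer.Properties as ℤP
  open import Data.Integer.Divisibility.Signed
  open import Data.Product using (∃-syntax; _,_; proj₁; proj₂)
  open import Relation.Nullary using (¬_)
  open import Relation.Binary.PropositionalEquality using (sym; trans; cong; subst)
  open import Function.Bundles using (_⇔_; mk⇔; Equivalence)

  m : ℕ
  m = 2 ^ a ℕ.* p ^ b

  -- p divides no W x: otherwise p ∣ U (2x), so the odd z(p) divides x, p ∣ U x,
  -- and the Pell equation makes p ∣ 1.
  p∤W : ∀ x → ¬ (+ p ∣ W x)
  p∤W x p∣Wx = prime∤1 p-prime (pell-coprime x p∣Ux p∣Wx)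
    where
    zp = (p ℕ.+ 1) / 2
    p∣Uzp : + p ∣ U zp
    p∣Uzp = ∣ᵤ⇒∣ (proj₁ (proj₂ rank-p))
    p∣U2x : + p ∣ U (x ℕ.+ x)
    p∣U2x = subst (+ p ∣_) (sym (U-double x)) (∣n⇒∣m*n (+ 2 * U x) p∣Wx)
    zp∣x : zp ℕD.∣ x
    zp∣x = odd-∣-double (≡5-mod-8⇒half-odd p p≡5)
      (rank-divides rank-p (cancellable-prime zp p-prime p∣Uzp) (x ℕ.+ x) p∣U2x)
    p∣Ux : + p ∣ U x
    p∣Ux = subst (λ n → + p ∣ U n) (sym (ℕD._∣_.equality zp∣x)) (U-multiples p∣Uzp (ℕD.quotient zp∣x))

  W-cancel : ∀ x c → + m ∣ c * W x → + m ∣ c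
  W-cancel x c m∣cW = ∣ᵤ⇒∣ (prime-powers-cancel a b ∣ c ∣ prime[2] p-prime (≡5-mod-8⇒∤2 p-prime p≡5)
    (λ 2∣W → W-odd x (∣ᵤ⇒∣ 2∣W)) (λ p∣W → p∤W x (∣ᵤ⇒∣ p∣W))
    (subst (m ℕD.∣_) (trans (ℤP.abs-* c (W x)) (ℕP.*-comm ∣ c ∣ ∣ W x ∣)) (∣⇒∣ᵤ m∣cW)))

  doubling-criterion : ∀ v x → (+ m ∣ + 2 * U v * W x) ⇔ (+ m ∣ U (v ℕ.+ v))
  doubling-criterion v x = mk⇔
    (λ m∣2UW → subst (+ m ∣_) (sym (U-double v)) (∣m⇒∣m*n (W v) (W-cancel x (+ 2 * U v) m∣2UW)))
    (λ m∣U2v → ∣m⇒∣m*n (W x) (W-cancel v (+ 2 * U v) (subst (+ m ∣_) (U-double v) m∣U2v)))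

  gap-criterion : ∀ i v → (+ m ∣ U (i ℕ.+ (v ℕ.+ v)) - U i) ⇔ (+ m ∣ U (v ℕ.+ v))
  gap-criterion i v = subst (λ t → (+ m ∣ t) ⇔ (+ m ∣ U (v ℕ.+ v))) (sym (U-difference v i))
    (doubling-criterion v (i ℕ.+ v))

  m∣Uz : + m ∣ U z
  m∣Uz = ∣ᵤ⇒∣ (proj₁ (proj₂ rank-m))

  2∣m : + 2 ∣ + m
  2∣m = ∣ᵤ⇒∣ (ℕD.∣-trans (n∣n^a 2 a≥1) (ℕD.m∣m*n (p ^ b)))

  -- Since m is even and U n ≡ n (mod 2), the rank z is even.
  z-even : ∃[ k ] z ≡ k ℕ.+ k
  z-even = half (gap-even 0 z (∣-trans 2∣m (subst (+ m ∣_) (sym (ℤP.+-identityʳ (U z))) m∣Uz)))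

  -- With z = k + k, the gap criterion at i = 1 gives U (z + 1) ≡ 1 (mod m) ...
  U-after-rank : ∃[ k ] z ≡ k ℕ.+ k → + m ∣ U (ℕ.suc z) - + 1
  U-after-rank (k , z≡k+k) = subst (λ n → + m ∣ U (ℕ.suc n) - + 1) (sym z≡k+k)
    (Equivalence.from (gap-criterion 1 k) (subst (λ n → + m ∣ U n) z≡k+k m∣Uz))

  -- ... so U (z + 1) is cancellable and z divides every zero of U modulo m.
  z-divides : ∀ n → + m ∣ U n → z ℕD.∣ n
  z-divides = rank-divides rank-m (cancellable-unit {+ m} {U (ℕ.suc z)} (U-after-rank z-even))

  -- Conversely U (i + q z) ≡ U i (mod m), as q z = q k + q k and m ∣ U (q z).
  period : ∃[ k ] z ≡ k ℕ.+ k → ∀ i q → + m ∣ U (i ℕ.+ q ℕ.* z) - U i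
  period (k , z≡k+k) i q = subst (λ n → + m ∣ U (i ℕ.+ n) - U i) (sym split)
    (Equivalence.from (gap-criterion i (q ℕ.* k)) (subst (λ n → + m ∣ U n) split (U-multiples m∣Uz q)))
    where
    split : q ℕ.* z ≡ q ℕ.* k ℕ.+ q ℕ.* k
    split = trans (cong (q ℕ.*_) z≡k+k) (ℕP.*-distribˡ-+ q k k)

  -- U (i + d) ≡ U i (mod m) iff d is even with m ∣ U d, iff z ∣ d.
  gap-characterisation : ∀ i d → (+ m ∣ U (i ℕ.+ d) - U i) ⇔ (z ℕD.∣ d)
  gap-characterisation i d = mk⇔ to from
    where
    to : + m ∣ U (i ℕ.+ d) - U i → z ℕD.∣ d
    to m∣gap = even-gap (half (gap-even i d (∣-trans 2∣m m∣gap)))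
      where
      even-gap : ∃[ v ] d ≡ v ℕ.+ v → z ℕD.∣ d
      even-gap (v , d≡v+v) = subst (z ℕD.∣_) (sym d≡v+v) (z-divides (v ℕ.+ v)
        (Equivalence.to (gap-criterion i v) (subst (λ n → + m ∣ U (i ℕ.+ n) - U i) d≡v+v m∣gap)))
    from : z ℕD.∣ d → + m ∣ U (i ℕ.+ d) - U i
    from (ℕD.divides q d≡q*z) =
      subst (λ n → + m ∣ U (i ℕ.+ n) - U i) (sym d≡q*z) (period z-even i q)

  U-congruence : ∀ i d → (U i ≡ U (i ℕ.+ d) [mod m ]) ⇔ ((+ i) ≡ (+ (i ℕ.+ d)) [mod z ])
  U-congruence i d = mk⇔
    (λ U-cong → Equivalence.from (index-mod i d)
                  (Equivalence.to (gap-characterisation i d) (Equivalence.to modU U-cong)))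
    (λ i-cong → Equivalence.from modU
                  (Equivalence.from (gap-characterisation i d) (Equivalence.to (index-mod i d) i-cong)))
    where
    modU : (U i ≡ U (i ℕ.+ d) [mod m ]) ⇔ (+ m ∣ U (i ℕ.+ d) - U i)
    modU = mod⇔∣ {U i} {U (i ℕ.+ d)} {m}

open import Data.Nat using (_≤_; _*_; _+_)
open import Data.Nat.Properties using (≤-total; m≤n⇒∃[o]m+o≡n)
open import Data.Integer using (+_)
open import Data.Product using (_,_)
open import Relation.Binary.Consequences using (wlog)
open import Relation.Binary.PropositionalEquality using (refl)
open import Function.Bundles using (_⇔_; mk⇔; Equivalence)

-- Both congruences are symmetric in i and j, so it suffices to take j = i + d.
lemma9 : (a b₁ p₁ : ℕ) → 1 ≤ a → 1 ≤ b₁ → Prime p₁ → p₁ % 8 ≡ 5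
       → IsRankOfApparition p₁ ((p₁ + 1) / 2)
       → (zm : ℕ) → IsRankOfApparition (2 ^ a * p₁ ^ b₁) zm
       → (i j : ℕ)
       → (U i ≡ U j [mod 2 ^ a * p₁ ^ b₁ ]) ⇔ ((+ i) ≡ (+ j) [mod zm ])
lemma9 a b₁ p₁ a≥1 _ p-prime p≡5 rank-p zm rank-m =
  wlog {Q = Congruences} ≤-total (λ {i} {j} → swap i j) ordered
  where
  open Modulus a b₁ p₁ a≥1 p-prime p≡5 rank-p zm rank-m using (U-congruence)
  open Divisibility using (mod-sym)

  Congruences : ℕ → ℕ → Set
  Congruences i j = (U i ≡ U j [mod 2 ^ a * p₁ ^ b₁ ]) ⇔ ((+ i) ≡ (+ j) [mod zm ])

  swap : ∀ i j → Congruences i j → Congruences j i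
  swap i j i~j =
    mk⇔ (λ U-cong → mod-sym (+ i) (+ j) (Equivalence.to i~j (mod-sym (U j) (U i) U-cong)))
        (λ i-cong → mod-sym (U i) (U j) (Equivalence.from i~j (mod-sym (+ j) (+ i) i-cong)))

  ordered : ∀ i j → i ≤ j → Congruences i j
  ordered i j i≤j with m≤n⇒∃[o]m+o≡n i≤j
  ... | d , refl = U-congruence i d
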